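{- Let $s,t$ be positive integers, let $M$ be an $(s,t)$-spike with associated partition $(A_1,\dots,A_m)$, and suppose $(P_1,\dots,P_k)$ is a partition of $E(M)$ such that for each $i\in\{1,\dots,k\}$ we have $P_i=\bigcup_{j\in I_i}A_j$ for some subset $I_i\subseteq\{1,\dots,m\}$ with $|I_i|\ge\max\{s-1,t-1\}$. Then $(P_1,\dots,P_k)$ is an $(s+t-1)$-anemone of $M$.
   Context: For positive integers $s,t$, an $(s,t)$-spike of order $m$ is a matroid $M$ with $m\ge\max\{s,t\}$ together with an associated partition $(A_1,\dots,A_m)$ of $E(M)$ into $2$-element sets (arms) such that the union of any $s$ arms is a circuit of $M$ and the union of any $t$ arms is a cocircuit of $M$. The connectivity function is $\lambda(X)=r(X)+r(E(M)-X)-r(M)$. Following Aikin and Oxley, for a positive integer $n$, a partition $(P_1,\dots,P_k)$ of $E(M)$ is an $n$-anemone if $|P_i|\ge n-1$ for every $i$ and $\lambda\big(\bigcup_{i\in I}P_i\big)=n-1$ for every $I$ with $\emptyset\ne I\subsetneq\{1,\dots,k\}$. -}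

module Defs where

open import Data.Nat using (ℕ; suc; _+_; _∸_; _≤_; _<_; _⊔_)
open import Data.Fin using (Fin; _≟_)
open import Data.Fin.Subset using (Subset; ∣_∣; _⊆_; _⊂_; _∪_; _∩_; ∁; ⊤; Nonempty)
open import Data.Vec using (tabulate; lookup)
open import Data.Product using (Σ; _×_; ∃)
open import Relation.Nullary using (¬_; does)
open import Relation.Binary.PropositionalEquality using (_≡_)

record Matroid (n : ℕ) : Set where
  field
    r        : Subset n → ℕ
    r-bound  : ∀ X → r X ≤ ∣ X ∣
    r-mono   : ∀ X Y → X ⊆ Y → r X ≤ r Y
    r-submod : ∀ X Y → r (X ∪ Y) + r (X ∩ Y) ≤ r X + r Y

module _ {n : ℕ} (M : Matroid n) where
  open Matroid M

  rankM : ℕ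
  rankM = r ⊤

  dualRank : Subset n → ℕ
  dualRank X = ∣ X ∣ + r (∁ X) ∸ r ⊤

  Dependent : Subset n → Set
  Dependent X = r X < ∣ X ∣

  IsCircuit : Subset n → Set
  IsCircuit C = Dependent C × (∀ D → D ⊂ C → ¬ Dependent D)

  IsCocircuit : Subset n → Set
  IsCocircuit C = (dualRank C < ∣ C ∣) × (∀ D → D ⊂ C → ¬ (dualRank D < ∣ D ∣))

  conn : Subset n → ℕ
  conn X = r X + r (∁ X) ∸ r ⊤

block : ∀ {n m} → (Fin n → Fin m) → Fin m → Subset n
block f i = tabulate (λ e → does (f e ≟ i))

blockUnion : ∀ {n m} → (Fin n → Fin m) → Subset m → Subset n
blockUnion f J = tabulate (λ e → lookup J (f e))

-- A partition (P_1,...,P_k) of E = Fin n, encoded by a labelling;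
-- blocks of a partition are nonempty.
IsPartition : ∀ {n k} → (Fin n → Fin k) → Set
IsPartition {k = k} P = ∀ (i : Fin k) → Nonempty (block P i)

-- (s,t)-spike of order m with associated partition into arms given by `arm`
IsSpike : ∀ {n} → Matroid n → (s t m : ℕ) → (Fin n → Fin m) → Set
IsSpike M s t m arm =
  (s ⊔ t ≤ m)
  × (∀ j → ∣ block arm j ∣ ≡ 2)
  × (∀ J → ∣ J ∣ ≡ s → IsCircuit M (blockUnion arm J))
  × (∀ J → ∣ J ∣ ≡ t → IsCocircuit M (blockUnion arm J))

IsAnemone : ∀ {N k} → Matroid N → (n : ℕ) → (Fin N → Fin k) → Set
IsAnemone M n P =
  IsPartition P
  × (∀ i → n ∸ 1 ≤ ∣ block P i ∣)
  × (∀ I → Nonempty I → Nonempty (∁ I) → conn M (blockUnion P I) ≡ n ∸ 1)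

-- Write s = x + 1 and t = y + 1.  Adding an arm to a set that already contains
-- x whole arms raises the rank by at most one (the new arm closes a circuit),
-- while adding an arm to a set whose complement still contains y further arms
-- raises it by at least one (the new arm meets a cocircuit disjoint from the
-- set).  Hence, for a set J of arms with at least max(x, y) arms on each side,
-- r(⋃J) = x + |J| and r(M) + y = r(⋃(E - J)) + |J|, so λ(⋃J) = x + y.  A union
-- of blocks of (P_i) is such a ⋃J, because every block is a union of arms.
module Submission where

open import Data.Bool using (Bool; true)
open import Data.Empty using (⊥-elim)
open import Data.Fin using (Fin; zero; suc; _≟_)
open import Data.Fin.Subset
open import Data.Fin.Subset.Induction using (⊂-wellFounded)
open import Data.Fin.Subset.Properties
open import Data.Nat using (ℕ; zero; suc; _+_; _∸_; _≤_; _<_; _⊔_; NonZero; s≤s; z≤n; _≤?_)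
open import Data.Nat.Properties hiding (_≟_)
open import Data.Product using (Σ; ∃; _×_; _,_; proj₁; proj₂; map₂)
open import Data.Sum using (inj₁; inj₂)
import Data.Sum as Sum
open import Data.Vec using ([]; _∷_; tabulate; lookup; here; there)
open import Data.Vec.Properties using ([]=⇒lookup; lookup⇒[]=; lookup∘tabulate; tabulate-cong)
open import Function using (id; _∘_)
open import Induction.WellFounded using (module All)
open import Level using (0ℓ)
open import Relation.Nullary using (¬_; yes; no; does)
open import Relation.Nullary.Decidable using (dec-true)
open import Relation.Binary.PropositionalEquality hiding (J)
open import Defs

private
  variable
    n m k : ℕ

-- Finite sets

Disjoint : Subset n → Subset n → Set
Disjoint p q = ∀ {x} → x ∈ p → x ∉ q

∣p∪q∣≡∣p∣+∣q∣ : (p q : Subset n) → Disjoint p q → ∣ p ∪ q ∣ ≡ ∣ p ∣ + ∣ q ∣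
∣p∪q∣≡∣p∣+∣q∣ []            []            _ = refl
∣p∪q∣≡∣p∣+∣q∣ (inside  ∷ p) (inside  ∷ q) d = ⊥-elim (d here here)
∣p∪q∣≡∣p∣+∣q∣ (inside  ∷ p) (outside ∷ q) d =
  cong suc (∣p∪q∣≡∣p∣+∣q∣ p q (λ x∈p x∈q → d (there x∈p) (there x∈q)))
∣p∪q∣≡∣p∣+∣q∣ (outside ∷ p) (inside  ∷ q) d =
  trans (cong suc (∣p∪q∣≡∣p∣+∣q∣ p q (λ x∈p x∈q → d (there x∈p) (there x∈q))))
        (sym (+-suc _ _))
∣p∪q∣≡∣p∣+∣q∣ (outside ∷ p) (outside ∷ q) d =
  ∣p∪q∣≡∣p∣+∣q∣ p q (λ x∈p x∈q → d (there x∈p) (there x∈q))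

∣⁅x⁆∪p∣≡1+∣p∣ : ∀ {x : Fin n} {p} → x ∉ p → ∣ ⁅ x ⁆ ∪ p ∣ ≡ suc ∣ p ∣
∣⁅x⁆∪p∣≡1+∣p∣ {x = x} {p} x∉p =
  trans (∣p∪q∣≡∣p∣+∣q∣ ⁅ x ⁆ p (λ y∈⁅x⁆ → subst (_∉ p) (sym (x∈⁅y⁆⇒x≡y x y∈⁅x⁆)) x∉p))
        (cong (_+ ∣ p ∣) (∣⁅x⁆∣≡1 x))

∪-least : {p q r : Subset n} → p ⊆ r → q ⊆ r → p ∪ q ⊆ r
∪-least {p = p} {q} p⊆r q⊆r x∈p∪q = Sum.[ p⊆r , q⊆r ] (x∈p∪q⁻ p q x∈p∪q)

x∈p⇒⁅x⁆⊆p : ∀ {x} {p : Subset n} → x ∈ p → ⁅ x ⁆ ⊆ p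
x∈p⇒⁅x⁆⊆p {x = x} {p} x∈p y∈⁅x⁆ = subst (_∈ p) (sym (x∈⁅y⁆⇒x≡y x y∈⁅x⁆)) x∈p

x∈p─q⇒x∉q : (p q : Subset n) {x : Fin n} → x ∈ p ─ q → x ∉ q
x∈p─q⇒x∉q (_ ∷ p) (inside  ∷ q) {zero}  ()
x∈p─q⇒x∉q (_ ∷ p) (outside ∷ q) {zero}  _          ()
x∈p─q⇒x∉q (_ ∷ p) (_       ∷ q) {suc x} (there h) (there h′) = x∈p─q⇒x∉q p q h h′

x∈p-y⇒x≢y : ∀ (p : Subset n) {x y} → x ∈ p - y → x ≢ y
x∈p-y⇒x≢y p {y = y} x∈p-y refl = x∈p─q⇒x∉q p ⁅ y ⁆ x∈p-y (x∈⁅x⁆ y)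

p⊆q⇒p∪[q─p]≡q : {p q : Subset n} → p ⊆ q → p ∪ (q ─ p) ≡ q
p⊆q⇒p∪[q─p]≡q {p = p} {q} p⊆q = ⊆-antisym to from
  where
  to : p ∪ (q ─ p) ⊆ q
  to = ∪-least p⊆q (p─q⊆p q p)
  from : q ⊆ p ∪ (q ─ p)
  from {x} x∈q with x ∈? p
  ... | yes x∈p = x∈p∪q⁺ (inj₁ x∈p)
  ... | no  x∉p = x∈p∪q⁺ (inj₂ (x∈p∧x∉q⇒x∈p─q x∈q x∉p))

∣q∣≡∣p∣+∣q─p∣ : {p q : Subset n} → p ⊆ q → ∣ q ∣ ≡ ∣ p ∣ + ∣ q ─ p ∣
∣q∣≡∣p∣+∣q─p∣ {p = p} {q} p⊆q =
  trans (cong ∣_∣ (sym (p⊆q⇒p∪[q─p]≡q p⊆q)))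
        (∣p∪q∣≡∣p∣+∣q∣ p (q ─ p) (λ x∈p x∈q─p → x∈p─q⇒x∉q q p x∈q─p x∈p))

∣p∣≡1+∣p-x∣ : ∀ {p : Subset n} {x} → x ∈ p → ∣ p ∣ ≡ suc ∣ p - x ∣
∣p∣≡1+∣p-x∣ {p = p} {x} x∈p =
  trans (∣q∣≡∣p∣+∣q─p∣ (x∈p⇒⁅x⁆⊆p x∈p))
        (cong (_+ ∣ p - x ∣) (∣⁅x⁆∣≡1 x))

∃⊆-of-size : ∀ k (p : Subset n) → k ≤ ∣ p ∣ → ∃ λ q → q ⊆ p × ∣ q ∣ ≡ k
∃⊆-of-size {n} zero p _ = ⊥ , ⊥⊆ , ∣⊥∣≡0 n
∃⊆-of-size (suc k) (inside  ∷ p) (s≤s k≤∣p∣) with ∃⊆-of-size k p k≤∣p∣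
... | q , q⊆p , ∣q∣≡k = inside ∷ q , in⊆in q⊆p , cong suc ∣q∣≡k
∃⊆-of-size (suc k) (outside ∷ p) k<∣p∣ with ∃⊆-of-size (suc k) p k<∣p∣
... | q , q⊆p , ∣q∣≡k = outside ∷ q , out⊆ q⊆p , ∣q∣≡k

∪-induction : (P : Subset n → Set) → P ⊥ →
              (∀ {x p} → x ∉ p → P p → P (⁅ x ⁆ ∪ p)) → ∀ p → P p
∪-induction P base step = All.wfRec ⊂-wellFounded 0ℓ P go
  where
  go : ∀ p → (∀ {q} → q ⊂ p → P q) → P p
  go p rec with nonempty? p
  ... | no  p-empty  = subst P (sym (Empty-unique p-empty)) base
  ... | yes (x , x∈p) = subst P (p⊆q⇒p∪[q─p]≡q (x∈p⇒⁅x⁆⊆p x∈p))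
                          (step (λ x∈p-x → x∈p-y⇒x≢y p x∈p-x refl) (rec (x∈p⇒p-x⊂p x∈p)))

-- Blocks of a labelling

∈-tabulate⁻ : ∀ {h : Fin n → Bool} {x} → x ∈ tabulate h → h x ≡ true
∈-tabulate⁻ {h = h} {x} x∈ = trans (sym (lookup∘tabulate h x)) ([]=⇒lookup x∈)

∈-tabulate⁺ : ∀ {h : Fin n → Bool} {x} → h x ≡ true → x ∈ tabulate h
∈-tabulate⁺ {h = h} {x} hx = lookup⇒[]= x _ (trans (lookup∘tabulate h x) hx)

module _ (f : Fin n → Fin m) where

  ∈-blockUnion⁻ : ∀ {J e} → e ∈ blockUnion f J → f e ∈ J
  ∈-blockUnion⁻ e∈ = lookup⇒[]= _ _ (∈-tabulate⁻ e∈)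

  ∈-blockUnion⁺ : ∀ {J e} → f e ∈ J → e ∈ blockUnion f J
  ∈-blockUnion⁺ fe∈J = ∈-tabulate⁺ ([]=⇒lookup fe∈J)

  ∈-block⁻ : ∀ {i e} → e ∈ block f i → f e ≡ i
  ∈-block⁻ {i} {e} e∈ with f e ≟ i | ∈-tabulate⁻ {h = λ e → does (f e ≟ i)} e∈
  ... | yes fe≡i | _ = fe≡i

  ∈-block⁺ : ∀ {i e} → f e ≡ i → e ∈ block f i
  ∈-block⁺ {i} {e} fe≡i = ∈-tabulate⁺ {h = λ e → does (f e ≟ i)} (dec-true (f e ≟ i) fe≡i)

  blockUnion-mono : ∀ {J K} → J ⊆ K → blockUnion f J ⊆ blockUnion f K
  blockUnion-mono J⊆K e∈ = ∈-blockUnion⁺ (J⊆K (∈-blockUnion⁻ e∈))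

  block⊆blockUnion : ∀ {i J} → i ∈ J → block f i ⊆ blockUnion f J
  block⊆blockUnion i∈J e∈ = ∈-blockUnion⁺ (subst (_∈ _) (sym (∈-block⁻ e∈)) i∈J)

  blockUnion-⊥ : ∀ {e} → e ∉ blockUnion f ⊥
  blockUnion-⊥ e∈ = ∉⊥ (∈-blockUnion⁻ e∈)

  blockUnion-∪ : ∀ J K → blockUnion f (J ∪ K) ≡ blockUnion f J ∪ blockUnion f K
  blockUnion-∪ J K = ⊆-antisym
    (λ e∈ → x∈p∪q⁺ (Sum.map ∈-blockUnion⁺ ∈-blockUnion⁺ (x∈p∪q⁻ J K (∈-blockUnion⁻ e∈))))
    (∪-least (blockUnion-mono (p⊆p∪q {p = J} K)) (blockUnion-mono (q⊆p∪q J K)))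

  blockUnion-⁅⁆ : ∀ i → blockUnion f ⁅ i ⁆ ≡ block f i
  blockUnion-⁅⁆ i = ⊆-antisym
    (λ e∈ → ∈-block⁺ (x∈⁅y⁆⇒x≡y i (∈-blockUnion⁻ e∈)))
    (block⊆blockUnion (x∈⁅x⁆ i))

  ∁-blockUnion : ∀ J → ∁ (blockUnion f J) ≡ blockUnion f (∁ J)
  ∁-blockUnion J = ⊆-antisym
    (λ e∈ → ∈-blockUnion⁺ (x∉p⇒x∈∁p (λ fe∈J → x∈∁p⇒x∉p e∈ (∈-blockUnion⁺ {J} fe∈J))))
    (λ e∈ → x∉p⇒x∈∁p (λ e∈′ → x∈∁p⇒x∉p (∈-blockUnion⁻ {∁ J} e∈) (∈-blockUnion⁻ {J} e∈′)))

-- Rank, circuits and cocircuits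

m+n∸o<m⇒n<o : ∀ m n o → m + n ∸ o < m → n < o
m+n∸o<m⇒n<o m n o m+n∸o<m with o ≤? n
... | yes o≤n = ⊥-elim (<⇒≱ m+n∸o<m (≤-trans (m≤m+n m (n ∸ o)) (≤-reflexive (sym (+-∸-assoc m o≤n)))))
... | no  o≰n = ≰⇒> o≰n

m+n∸o≮m⇒o≤n : ∀ {m} n o → 0 < m → ¬ (m + n ∸ o < m) → o ≤ n
m+n∸o≮m⇒o≤n {suc m} n o _ m+n∸o≮m with o ≤? n
... | yes o≤n = o≤n
... | no  o≰n = ⊥-elim (m+n∸o≮m (≤-trans (s≤s (∸-monoʳ-≤ (suc m + n) (≰⇒> o≰n)))
                                          (≤-reflexive (cong suc (m+n∸n≡m m n)))))

module _ (M : Matroid n) where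
  open Matroid M
  open ≤-Reasoning

  r-∪≤ : ∀ X Y → r (X ∪ Y) ≤ r X + ∣ Y ∣
  r-∪≤ X Y = ≤-trans (m≤m+n _ _) (≤-trans (r-submod X Y) (+-monoʳ-≤ (r X) (r-bound Y)))

  circuit⇒r≤r[C-e] : ∀ {C e} → IsCircuit M C → e ∈ C → r C ≤ r (C - e)
  circuit⇒r≤r[C-e] {C} {e} (C-dependent , C-minimal) e∈C = begin
    r C           ≤⟨ ≤-pred (subst (r C <_) (∣p∣≡1+∣p-x∣ e∈C) C-dependent) ⟩
    ∣ C - e ∣     ≤⟨ ≮⇒≥ (C-minimal (C - e) (x∈p⇒p-x⊂p e∈C)) ⟩
    r (C - e)     ∎

  circuit-closure : ∀ {C X e} → IsCircuit M C → e ∈ C → C - e ⊆ X → r (X ∪ C) ≤ r X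
  circuit-closure {C} {X} {e} C-circuit e∈C C-e⊆X =
    +-cancelʳ-≤ (r (X ∩ C)) (r (X ∪ C)) (r X) (begin
      r (X ∪ C) + r (X ∩ C) ≤⟨ r-submod X C ⟩
      r X + r C             ≤⟨ +-monoʳ-≤ (r X) (circuit⇒r≤r[C-e] C-circuit e∈C) ⟩
      r X + r (C - e)       ≤⟨ +-monoʳ-≤ (r X) (r-mono _ _ C-e⊆X∩C) ⟩
      r X + r (X ∩ C)       ∎)
    where
    C-e⊆X∩C : C - e ⊆ X ∩ C
    C-e⊆X∩C z∈ = x∈p∩q⁺ (C-e⊆X z∈ , p─q⊆p C ⁅ e ⁆ z∈)

  cocircuit⇒r∁<r⊤ : ∀ {C} → IsCocircuit M C → r (∁ C) < r ⊤
  cocircuit⇒r∁<r⊤ {C} (C-codependent , _) = m+n∸o<m⇒n<o ∣ C ∣ (r (∁ C)) (r ⊤) C-codependent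

  cocircuit⇒r⊤≤r∁[C-e] : ∀ {C e} → IsCocircuit M C → e ∈ C → r ⊤ ≤ r (∁ (C - e))
  cocircuit⇒r⊤≤r∁[C-e] {C} {e} (_ , C-minimal) e∈C with nonempty? (C - e)
  ... | yes (z , z∈) = m+n∸o≮m⇒o≤n (r (∁ (C - e))) (r ⊤) (≤-<-trans z≤n (x∈p⇒∣p-x∣<∣p∣ z∈))
                         (C-minimal (C - e) (x∈p⇒p-x⊂p e∈C))
  ... | no  C-e-empty = r-mono ⊤ _ (λ {z} _ → x∉p⇒x∈∁p (λ z∈ → C-e-empty (z , z∈)))

  cocircuit-raises-rank : ∀ {C Z e} → IsCocircuit M C → e ∈ C → Z ⊆ ∁ C → r Z < r (Z ∪ ⁅ e ⁆)
  cocircuit-raises-rank {C} {Z} {e} C-cocircuit e∈C Z⊆∁C =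
    +-cancelˡ-< (r ⊤) (r Z) (r A) (begin-strict
      r ⊤ + r Z                 ≤⟨ +-monoˡ-≤ (r Z) r⊤≤r[A∪∁C] ⟩
      r (A ∪ ∁ C) + r Z         ≤⟨ +-monoʳ-≤ (r (A ∪ ∁ C)) (r-mono _ _ Z⊆A∩∁C) ⟩
      r (A ∪ ∁ C) + r (A ∩ ∁ C) ≤⟨ r-submod A (∁ C) ⟩
      r A + r (∁ C)             <⟨ +-monoʳ-< (r A) (cocircuit⇒r∁<r⊤ C-cocircuit) ⟩
      r A + r ⊤                 ≡⟨ +-comm (r A) (r ⊤) ⟩
      r ⊤ + r A                 ∎)
    where
    A = Z ∪ ⁅ e ⁆
    ∁[C-e]⊆A∪∁C : ∁ (C - e) ⊆ A ∪ ∁ C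
    ∁[C-e]⊆A∪∁C {z} z∈ with z ≟ e
    ... | yes refl = x∈p∪q⁺ (inj₁ (x∈p∪q⁺ (inj₂ (x∈⁅x⁆ z))))
    ... | no  z≢e  = x∈p∪q⁺ (inj₂ (x∉p⇒x∈∁p (λ z∈C → x∈∁p⇒x∉p z∈ (x∈p∧x≢y⇒x∈p-y z∈C z≢e))))
    r⊤≤r[A∪∁C] : r ⊤ ≤ r (A ∪ ∁ C)
    r⊤≤r[A∪∁C] = ≤-trans (cocircuit⇒r⊤≤r∁[C-e] C-cocircuit e∈C) (r-mono _ _ ∁[C-e]⊆A∪∁C)
    Z⊆A∩∁C : Z ⊆ A ∩ ∁ C
    Z⊆A∩∁C z∈Z = x∈p∩q⁺ (x∈p∪q⁺ (inj₁ z∈Z) , Z⊆∁C z∈Z)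

-- Spikes

module Spike (x y : ℕ) (M : Matroid n) (arm : Fin n → Fin m)
             (spike : IsSpike M (suc x) (suc y) m arm) where
  open Matroid M

  Arm : Fin m → Subset n
  Arm = block arm

  Arms : Subset m → Subset n
  Arms = blockUnion arm

  ∣Arm∣≡2 : ∀ a → ∣ Arm a ∣ ≡ 2
  ∣Arm∣≡2 = proj₁ (proj₂ spike)

  Arms-circuit : ∀ {K a} → ∣ K ∣ ≡ x → a ∉ K → IsCircuit M (Arms (⁅ a ⁆ ∪ K))
  Arms-circuit {K} {a} ∣K∣≡x a∉K =
    proj₁ (proj₂ (proj₂ spike)) (⁅ a ⁆ ∪ K) (trans (∣⁅x⁆∪p∣≡1+∣p∣ a∉K) (cong suc ∣K∣≡x))

  Arms-cocircuit : ∀ {T a} → ∣ T ∣ ≡ y → a ∉ T → IsCocircuit M (Arms (⁅ a ⁆ ∪ T))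
  Arms-cocircuit {T} {a} ∣T∣≡y a∉T =
    proj₂ (proj₂ (proj₂ spike)) (⁅ a ⁆ ∪ T) (trans (∣⁅x⁆∪p∣≡1+∣p∣ a∉T) (cong suc ∣T∣≡y))

  Arm-nonempty : ∀ a → Nonempty (Arm a)
  Arm-nonempty a with nonempty? (Arm a)
  ... | yes nonempty = nonempty
  ... | no  empty    =
    ⊥-elim (0≢1+n (trans (sym (∣⊥∣≡0 n)) (trans (cong ∣_∣ (sym (Empty-unique empty))) (∣Arm∣≡2 a))))

  Arms-⁅⁆∪ : ∀ a K → Arms (⁅ a ⁆ ∪ K) ≡ Arm a ∪ Arms K
  Arms-⁅⁆∪ a K = trans (blockUnion-∪ arm ⁅ a ⁆ K) (cong (_∪ Arms K) (blockUnion-⁅⁆ arm a))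

  Arm⊆Arms-⁅⁆∪ : ∀ a K → Arm a ⊆ Arms (⁅ a ⁆ ∪ K)
  Arm⊆Arms-⁅⁆∪ a K = block⊆blockUnion arm (x∈p∪q⁺ (inj₁ (x∈⁅x⁆ a)))

  Arm-Arms-disjoint : ∀ {a K} → a ∉ K → Disjoint (Arm a) (Arms K)
  Arm-Arms-disjoint a∉K e∈Arm e∈Arms = a∉K (subst (_∈ _) (∈-block⁻ arm e∈Arm) (∈-blockUnion⁻ arm e∈Arms))

  ∣Arms∣ : ∀ K → ∣ Arms K ∣ ≡ ∣ K ∣ + ∣ K ∣
  ∣Arms∣ = ∪-induction (λ K → ∣ Arms K ∣ ≡ ∣ K ∣ + ∣ K ∣) base step
    where
    open ≡-Reasoning
    base : ∣ Arms ⊥ ∣ ≡ ∣ ⊥ {m} ∣ + ∣ ⊥ {m} ∣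
    base = begin
      ∣ Arms ⊥ ∣            ≡⟨ cong ∣_∣ (Empty-unique (λ (_ , e∈) → blockUnion-⊥ arm e∈)) ⟩
      ∣ ⊥ {n} ∣             ≡⟨ ∣⊥∣≡0 n ⟩
      0                     ≡⟨ cong₂ _+_ (∣⊥∣≡0 m) (∣⊥∣≡0 m) ⟨
      ∣ ⊥ {m} ∣ + ∣ ⊥ {m} ∣ ∎
    step : ∀ {a K} → a ∉ K → ∣ Arms K ∣ ≡ ∣ K ∣ + ∣ K ∣ →
           ∣ Arms (⁅ a ⁆ ∪ K) ∣ ≡ ∣ ⁅ a ⁆ ∪ K ∣ + ∣ ⁅ a ⁆ ∪ K ∣
    step {a} {K} a∉K ih = begin
      ∣ Arms (⁅ a ⁆ ∪ K) ∣              ≡⟨ cong ∣_∣ (Arms-⁅⁆∪ a K) ⟩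
      ∣ Arm a ∪ Arms K ∣                ≡⟨ ∣p∪q∣≡∣p∣+∣q∣ _ _ (Arm-Arms-disjoint a∉K) ⟩
      ∣ Arm a ∣ + ∣ Arms K ∣            ≡⟨ cong₂ _+_ (∣Arm∣≡2 a) ih ⟩
      2 + (∣ K ∣ + ∣ K ∣)               ≡⟨ cong suc (+-suc ∣ K ∣ ∣ K ∣) ⟨
      suc ∣ K ∣ + suc ∣ K ∣             ≡⟨ cong₂ _+_ (∣⁅x⁆∪p∣≡1+∣p∣ a∉K) (∣⁅x⁆∪p∣≡1+∣p∣ a∉K) ⟨
      ∣ ⁅ a ⁆ ∪ K ∣ + ∣ ⁅ a ⁆ ∪ K ∣     ∎

  Arms-independent : ∀ {K a} → ∣ K ∣ ≡ x → a ∉ K → ∣ Arms K ∣ ≤ r (Arms K)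
  Arms-independent {K} {a} ∣K∣≡x a∉K with Arm-nonempty a
  ... | e , e∈Arm = ≮⇒≥ (proj₂ (Arms-circuit ∣K∣≡x a∉K) (Arms K) ArmsK⊂C)
    where
    ArmsK⊂C : Arms K ⊂ Arms (⁅ a ⁆ ∪ K)
    ArmsK⊂C = blockUnion-mono arm (q⊆p∪q ⁅ a ⁆ K)
            , e , Arm⊆Arms-⁅⁆∪ a K e∈Arm , Arm-Arms-disjoint a∉K e∈Arm

  r-∪-Arm≤ : ∀ {K W} → ∣ K ∣ ≡ x → Arms K ⊆ W → ∀ a → r (W ∪ Arm a) ≤ suc (r W)
  r-∪-Arm≤ {K} {W} ∣K∣≡x ArmsK⊆W a with a ∈? K | Arm-nonempty a
  ... | yes a∈K | _ =
    ≤-trans (r-mono _ _ (∪-least id (ArmsK⊆W ∘ block⊆blockUnion arm a∈K))) (n≤1+n (r W))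
  ... | no  a∉K | e , e∈Arm = begin
      r (W ∪ Arm a)       ≤⟨ r-mono _ _ W∪Arm⊆X∪C ⟩
      r (X ∪ C)           ≤⟨ circuit-closure M (Arms-circuit ∣K∣≡x a∉K) (Arm⊆Arms-⁅⁆∪ a K e∈Arm) C-e⊆X ⟩
      r X                 ≤⟨ r-∪≤ M W (Arm a - e) ⟩
      r W + ∣ Arm a - e ∣ ≡⟨ cong (r W +_) ∣Arm-e∣≡1 ⟩
      r W + 1             ≡⟨ +-comm (r W) 1 ⟩
      suc (r W)           ∎
    where
    open ≤-Reasoning
    C = Arms (⁅ a ⁆ ∪ K)
    X = W ∪ (Arm a - e)
    W∪Arm⊆X∪C : W ∪ Arm a ⊆ X ∪ C
    W∪Arm⊆X∪C = ∪-least (p⊆p∪q C ∘ p⊆p∪q (Arm a - e)) (q⊆p∪q X C ∘ Arm⊆Arms-⁅⁆∪ a K)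
    ∣Arm-e∣≡1 : ∣ Arm a - e ∣ ≡ 1
    ∣Arm-e∣≡1 = suc-injective (trans (sym (∣p∣≡1+∣p-x∣ e∈Arm)) (∣Arm∣≡2 a))
    C-e⊆X : C - e ⊆ X
    C-e⊆X {z} z∈ with x∈p∪q⁻ (Arm a) (Arms K) (subst (z ∈_) (Arms-⁅⁆∪ a K) (p─q⊆p C ⁅ e ⁆ z∈))
    ... | inj₁ z∈Arm   = x∈p∪q⁺ (inj₂ (x∈p∧x≢y⇒x∈p-y z∈Arm (x∈p-y⇒x≢y C z∈)))
    ... | inj₂ z∈ArmsK = x∈p∪q⁺ (inj₁ (ArmsK⊆W z∈ArmsK))

  r-∪-Arms≤ : ∀ {K W} → ∣ K ∣ ≡ x → Arms K ⊆ W → ∀ L → r (W ∪ Arms L) ≤ r W + ∣ L ∣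
  r-∪-Arms≤ {K} {W} ∣K∣≡x ArmsK⊆W = ∪-induction (λ L → r (W ∪ Arms L) ≤ r W + ∣ L ∣) base step
    where
    open ≤-Reasoning
    base : r (W ∪ Arms ⊥) ≤ r W + ∣ ⊥ {m} ∣
    base = ≤-trans (r-mono _ _ (∪-least id (⊥-elim ∘ blockUnion-⊥ arm))) (m≤m+n (r W) _)
    step : ∀ {a L} → a ∉ L → r (W ∪ Arms L) ≤ r W + ∣ L ∣ →
           r (W ∪ Arms (⁅ a ⁆ ∪ L)) ≤ r W + ∣ ⁅ a ⁆ ∪ L ∣
    step {a} {L} a∉L ih = begin
      r (W ∪ Arms (⁅ a ⁆ ∪ L))  ≡⟨ cong r regroup ⟩
      r ((W ∪ Arms L) ∪ Arm a)  ≤⟨ r-∪-Arm≤ {K} ∣K∣≡x (λ z∈ → p⊆p∪q (Arms L) (ArmsK⊆W z∈)) a ⟩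
      suc (r (W ∪ Arms L))      ≤⟨ s≤s ih ⟩
      suc (r W + ∣ L ∣)         ≡⟨ +-suc (r W) ∣ L ∣ ⟨
      r W + suc ∣ L ∣           ≡⟨ cong (r W +_) (∣⁅x⁆∪p∣≡1+∣p∣ a∉L) ⟨
      r W + ∣ ⁅ a ⁆ ∪ L ∣       ∎
      where
      regroup : W ∪ Arms (⁅ a ⁆ ∪ L) ≡ (W ∪ Arms L) ∪ Arm a
      regroup = trans (cong (W ∪_) (trans (Arms-⁅⁆∪ a L) (∪-comm (Arm a) (Arms L))))
                      (sym (∪-assoc W (Arms L) (Arm a)))

  r-Arms<r-Arms-⁅⁆∪ : ∀ {K a} → a ∉ K → y ≤ ∣ ∁ (⁅ a ⁆ ∪ K) ∣ → r (Arms K) < r (Arms (⁅ a ⁆ ∪ K))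
  r-Arms<r-Arms-⁅⁆∪ {K} {a} a∉K y≤ with ∃⊆-of-size y (∁ (⁅ a ⁆ ∪ K)) y≤ | Arm-nonempty a
  ... | T , T⊆ , ∣T∣≡y | e , e∈Arm = begin-strict
      r (Arms K)           <⟨ cocircuit-raises-rank M (Arms-cocircuit ∣T∣≡y a∉T)
                                                    (Arm⊆Arms-⁅⁆∪ a T e∈Arm) ArmsK⊆∁D ⟩
      r (Arms K ∪ ⁅ e ⁆)   ≤⟨ r-mono _ _ (∪-least (blockUnion-mono arm (q⊆p∪q ⁅ a ⁆ K))
                                                   (x∈p⇒⁅x⁆⊆p (Arm⊆Arms-⁅⁆∪ a K e∈Arm))) ⟩
      r (Arms (⁅ a ⁆ ∪ K)) ∎
    where
    open ≤-Reasoning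
    a∉T : a ∉ T
    a∉T a∈T = x∈∁p⇒x∉p (T⊆ a∈T) (x∈p∪q⁺ (inj₁ (x∈⁅x⁆ a)))
    K⊆∁[⁅a⁆∪T] : K ⊆ ∁ (⁅ a ⁆ ∪ T)
    K⊆∁[⁅a⁆∪T] {k} k∈K = x∉p⇒x∈∁p (Sum.[ (λ k∈⁅a⁆ → a∉K (subst (_∈ K) (x∈⁅y⁆⇒x≡y a k∈⁅a⁆) k∈K))
                                          , (λ k∈T → x∈∁p⇒x∉p (T⊆ k∈T) (x∈p∪q⁺ (inj₂ k∈K))) ]
                                     ∘ x∈p∪q⁻ ⁅ a ⁆ T)
    ArmsK⊆∁D : Arms K ⊆ ∁ (Arms (⁅ a ⁆ ∪ T))
    ArmsK⊆∁D = ⊆-trans (blockUnion-mono arm K⊆∁[⁅a⁆∪T])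
                       (⊆-reflexive (sym (∁-blockUnion arm (⁅ a ⁆ ∪ T))))

  r-Arms+∣L∣≤r-Arms-∪ : ∀ L {K} → Disjoint K L → y ≤ ∣ ∁ (K ∪ L) ∣ →
                        r (Arms K) + ∣ L ∣ ≤ r (Arms (K ∪ L))
  r-Arms+∣L∣≤r-Arms-∪ = ∪-induction P base step
    where
    open ≤-Reasoning
    P : Subset m → Set
    P L = ∀ {K} → Disjoint K L → y ≤ ∣ ∁ (K ∪ L) ∣ → r (Arms K) + ∣ L ∣ ≤ r (Arms (K ∪ L))
    base : P ⊥
    base {K} _ _ = begin
      r (Arms K) + ∣ ⊥ {m} ∣ ≡⟨ cong (r (Arms K) +_) (∣⊥∣≡0 m) ⟩
      r (Arms K) + 0         ≡⟨ +-identityʳ (r (Arms K)) ⟩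
      r (Arms K)             ≤⟨ r-mono _ _ (blockUnion-mono arm (p⊆p∪q {p = K} ⊥)) ⟩
      r (Arms (K ∪ ⊥))       ∎
    step : ∀ {a L} → a ∉ L → P L → P (⁅ a ⁆ ∪ L)
    step {a} {L} a∉L ih {K} K#⁅a⁆∪L y≤ = begin
      r (Arms K) + ∣ ⁅ a ⁆ ∪ L ∣   ≡⟨ cong (r (Arms K) +_) (∣⁅x⁆∪p∣≡1+∣p∣ a∉L) ⟩
      r (Arms K) + suc ∣ L ∣       ≡⟨ +-suc (r (Arms K)) ∣ L ∣ ⟩
      suc (r (Arms K)) + ∣ L ∣     ≤⟨ +-monoˡ-≤ ∣ L ∣ (r-Arms<r-Arms-⁅⁆∪ a∉K y≤∣∁K′∣) ⟩
      r (Arms K′) + ∣ L ∣          ≤⟨ ih K′#L (subst (λ S → y ≤ ∣ ∁ S ∣) (sym regroup) y≤) ⟩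
      r (Arms (K′ ∪ L))            ≡⟨ cong (r ∘ Arms) regroup ⟩
      r (Arms (K ∪ (⁅ a ⁆ ∪ L)))   ∎
      where
      K′ = ⁅ a ⁆ ∪ K
      regroup : K′ ∪ L ≡ K ∪ (⁅ a ⁆ ∪ L)
      regroup = trans (cong (_∪ L) (∪-comm ⁅ a ⁆ K)) (∪-assoc K ⁅ a ⁆ L)
      a∉K : a ∉ K
      a∉K a∈K = K#⁅a⁆∪L a∈K (x∈p∪q⁺ (inj₁ (x∈⁅x⁆ a)))
      K′#L : Disjoint K′ L
      K′#L k∈K′ k∈L = Sum.[ (λ k∈⁅a⁆ → a∉L (subst (_∈ L) (x∈⁅y⁆⇒x≡y a k∈⁅a⁆) k∈L))
                           , (λ k∈K → K#⁅a⁆∪L k∈K (x∈p∪q⁺ (inj₂ k∈L))) ]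
                          (x∈p∪q⁻ ⁅ a ⁆ K k∈K′)
      y≤∣∁K′∣ : y ≤ ∣ ∁ K′ ∣
      y≤∣∁K′∣ = ≤-trans y≤ (p⊆q⇒∣p∣≤∣q∣ (p⊆q⇒∁p⊇∁q (⊆-trans (p⊆p∪q L) (⊆-reflexive regroup))))

  r-Arms≡x+∣J∣ : ∀ {J} → x ≤ ∣ J ∣ → y ≤ ∣ ∁ J ∣ → Nonempty (∁ J) → r (Arms J) ≡ x + ∣ J ∣
  r-Arms≡x+∣J∣ {J} x≤∣J∣ y≤∣∁J∣ (a , a∈∁J) with ∃⊆-of-size x J x≤∣J∣
  ... | K , K⊆J , ∣K∣≡x = ≤-antisym upper lower
    where
    open ≤-Reasoning
    K∪[J─K]≡J : K ∪ (J ─ K) ≡ J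
    K∪[J─K]≡J = p⊆q⇒p∪[q─p]≡q K⊆J
    x+∣J∣≡∣ArmsK∣+∣J─K∣ : x + ∣ J ∣ ≡ ∣ Arms K ∣ + ∣ J ─ K ∣
    x+∣J∣≡∣ArmsK∣+∣J─K∣ = begin-equality
      x + ∣ J ∣                ≡⟨ cong (x +_) (∣q∣≡∣p∣+∣q─p∣ K⊆J) ⟩
      x + (∣ K ∣ + ∣ J ─ K ∣)  ≡⟨ +-assoc x ∣ K ∣ ∣ J ─ K ∣ ⟨
      x + ∣ K ∣ + ∣ J ─ K ∣    ≡⟨ cong (λ c → c + ∣ K ∣ + ∣ J ─ K ∣) ∣K∣≡x ⟨
      ∣ K ∣ + ∣ K ∣ + ∣ J ─ K ∣ ≡⟨ cong (_+ ∣ J ─ K ∣) (∣Arms∣ K) ⟨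
      ∣ Arms K ∣ + ∣ J ─ K ∣   ∎
    upper : r (Arms J) ≤ x + ∣ J ∣
    upper = begin
      r (Arms J)                ≡⟨ cong (r ∘ Arms) K∪[J─K]≡J ⟨
      r (Arms (K ∪ (J ─ K)))    ≡⟨ cong r (blockUnion-∪ arm K (J ─ K)) ⟩
      r (Arms K ∪ Arms (J ─ K)) ≤⟨ r-∪-Arms≤ {K} ∣K∣≡x ⊆-refl (J ─ K) ⟩
      r (Arms K) + ∣ J ─ K ∣    ≤⟨ +-monoˡ-≤ ∣ J ─ K ∣ (r-bound (Arms K)) ⟩
      ∣ Arms K ∣ + ∣ J ─ K ∣    ≡⟨ x+∣J∣≡∣ArmsK∣+∣J─K∣ ⟨
      x + ∣ J ∣                 ∎
    lower : x + ∣ J ∣ ≤ r (Arms J)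
    lower = begin
      x + ∣ J ∣                 ≡⟨ x+∣J∣≡∣ArmsK∣+∣J─K∣ ⟩
      ∣ Arms K ∣ + ∣ J ─ K ∣    ≤⟨ +-monoˡ-≤ ∣ J ─ K ∣ (Arms-independent ∣K∣≡x (x∈∁p⇒x∉p a∈∁J ∘ K⊆J)) ⟩
      r (Arms K) + ∣ J ─ K ∣    ≤⟨ r-Arms+∣L∣≤r-Arms-∪ (J ─ K) (λ k∈K k∈J─K → x∈p─q⇒x∉q J K k∈J─K k∈K)
                                     (subst (λ S → y ≤ ∣ ∁ S ∣) (sym K∪[J─K]≡J) y≤∣∁J∣) ⟩
      r (Arms (K ∪ (J ─ K)))    ≡⟨ cong (r ∘ Arms) K∪[J─K]≡J ⟩
      r (Arms J)                ∎

  r⊤+y≡r-Arms∁+∣J∣ : ∀ {J} → y ≤ ∣ J ∣ → x ≤ ∣ ∁ J ∣ → Nonempty (∁ J) →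
                     r ⊤ + y ≡ r (Arms (∁ J)) + ∣ J ∣
  r⊤+y≡r-Arms∁+∣J∣ {J} y≤∣J∣ x≤∣∁J∣ (a , a∈∁J)
    with ∃⊆-of-size y J y≤∣J∣ | ∃⊆-of-size x (∁ J) x≤∣∁J∣ | Arm-nonempty a
  ... | T , T⊆J , ∣T∣≡y | K , K⊆∁J , ∣K∣≡x | e , e∈Arm = ≤-antisym upper lower
    where
    open ≤-Reasoning
    R = J ─ T
    D = Arms (⁅ a ⁆ ∪ T)
    a∉T : a ∉ T
    a∉T = x∈∁p⇒x∉p a∈∁J ∘ T⊆J
    r∁+∣R∣+y≡r∁+∣J∣ : r (Arms (∁ J)) + ∣ R ∣ + y ≡ r (Arms (∁ J)) + ∣ J ∣
    r∁+∣R∣+y≡r∁+∣J∣ = trans (+-assoc (r (Arms (∁ J))) ∣ R ∣ y)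
      (cong (r (Arms (∁ J)) +_) (trans (+-comm ∣ R ∣ y)
        (sym (trans (∣q∣≡∣p∣+∣q─p∣ T⊆J) (cong (_+ ∣ R ∣) ∣T∣≡y)))))
    ∁[D-e]⊆ : ∁ (D - e) ⊆ Arms (∁ J) ∪ Arms R
    ∁[D-e]⊆ {z} z∉D-e with arm z ∈? J | arm z ∈? T
    ... | no  armz∉J | _          = x∈p∪q⁺ (inj₁ (∈-blockUnion⁺ arm (x∉p⇒x∈∁p armz∉J)))
    ... | yes armz∈J | no armz∉T  = x∈p∪q⁺ (inj₂ (∈-blockUnion⁺ arm (x∈p∧x∉q⇒x∈p─q armz∈J armz∉T)))
    ... | yes armz∈J | yes armz∈T =
      ⊥-elim (x∈∁p⇒x∉p z∉D-e (x∈p∧x≢y⇒x∈p-y (∈-blockUnion⁺ arm (q⊆p∪q ⁅ a ⁆ T armz∈T)) z≢e))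
      where
      z≢e : z ≢ e
      z≢e refl = x∈∁p⇒x∉p a∈∁J (subst (_∈ J) (∈-block⁻ arm e∈Arm) armz∈J)
    ∁J#R : Disjoint (∁ J) R
    ∁J#R j∈∁J j∈R = x∈∁p⇒x∉p j∈∁J (p─q⊆p J T j∈R)
    T⊆∁[∁J∪R] : T ⊆ ∁ (∁ J ∪ R)
    T⊆∁[∁J∪R] t∈T = x∉p⇒x∈∁p (Sum.[ (λ t∈∁J → x∈∁p⇒x∉p t∈∁J (T⊆J t∈T))
                                   , (λ t∈R → x∈p─q⇒x∉q J T t∈R t∈T) ]
                              ∘ x∈p∪q⁻ (∁ J) R)
    y≤∣∁[∁J∪R]∣ : y ≤ ∣ ∁ (∁ J ∪ R) ∣
    y≤∣∁[∁J∪R]∣ = ≤-trans (≤-reflexive (sym ∣T∣≡y)) (p⊆q⇒∣p∣≤∣q∣ T⊆∁[∁J∪R])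
    upper : r ⊤ + y ≤ r (Arms (∁ J)) + ∣ J ∣
    upper = begin
      r ⊤ + y                         ≤⟨ +-monoˡ-≤ y (cocircuit⇒r⊤≤r∁[C-e] M (Arms-cocircuit ∣T∣≡y a∉T)
                                                        (Arm⊆Arms-⁅⁆∪ a T e∈Arm)) ⟩
      r (∁ (D - e)) + y               ≤⟨ +-monoˡ-≤ y (r-mono _ _ ∁[D-e]⊆) ⟩
      r (Arms (∁ J) ∪ Arms R) + y     ≤⟨ +-monoˡ-≤ y (r-∪-Arms≤ {K} ∣K∣≡x (blockUnion-mono arm K⊆∁J) R) ⟩
      r (Arms (∁ J)) + ∣ R ∣ + y      ≡⟨ r∁+∣R∣+y≡r∁+∣J∣ ⟩
      r (Arms (∁ J)) + ∣ J ∣          ∎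
    lower : r (Arms (∁ J)) + ∣ J ∣ ≤ r ⊤ + y
    lower = begin
      r (Arms (∁ J)) + ∣ J ∣          ≡⟨ r∁+∣R∣+y≡r∁+∣J∣ ⟨
      r (Arms (∁ J)) + ∣ R ∣ + y      ≤⟨ +-monoˡ-≤ y (r-Arms+∣L∣≤r-Arms-∪ R ∁J#R y≤∣∁[∁J∪R]∣) ⟩
      r (Arms (∁ J ∪ R)) + y          ≤⟨ +-monoˡ-≤ y (r-mono _ _ ⊆⊤) ⟩
      r ⊤ + y                         ∎

  conn-Arms : ∀ {J} → x ⊔ y ≤ ∣ J ∣ → x ⊔ y ≤ ∣ ∁ J ∣ → Nonempty (∁ J) → conn M (Arms J) ≡ x + y
  conn-Arms {J} x⊔y≤∣J∣ x⊔y≤∣∁J∣ ∁J-nonempty = begin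
    r (Arms J) + r (∁ (Arms J)) ∸ r ⊤ ≡⟨ cong₂ (λ c S → c + r S ∸ r ⊤) r-ArmsJ (∁-blockUnion arm J) ⟩
    x + ∣ J ∣ + r (Arms (∁ J)) ∸ r ⊤  ≡⟨ cong (_∸ r ⊤) regroup ⟩
    x + y + r ⊤ ∸ r ⊤                 ≡⟨ m+n∸n≡m (x + y) (r ⊤) ⟩
    x + y                             ∎
    where
    open ≡-Reasoning
    r-ArmsJ : r (Arms J) ≡ x + ∣ J ∣
    r-ArmsJ = r-Arms≡x+∣J∣ (≤-trans (m≤m⊔n x y) x⊔y≤∣J∣) (≤-trans (m≤n⊔m x y) x⊔y≤∣∁J∣) ∁J-nonempty
    r⊤+y : r ⊤ + y ≡ r (Arms (∁ J)) + ∣ J ∣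
    r⊤+y = r⊤+y≡r-Arms∁+∣J∣ (≤-trans (m≤n⊔m x y) x⊔y≤∣J∣) (≤-trans (m≤m⊔n x y) x⊔y≤∣∁J∣) ∁J-nonempty
    regroup : x + ∣ J ∣ + r (Arms (∁ J)) ≡ x + y + r ⊤
    regroup = begin
      x + ∣ J ∣ + r (Arms (∁ J))   ≡⟨ +-assoc x ∣ J ∣ _ ⟩
      x + (∣ J ∣ + r (Arms (∁ J))) ≡⟨ cong (x +_) (+-comm ∣ J ∣ _) ⟩
      x + (r (Arms (∁ J)) + ∣ J ∣) ≡⟨ cong (x +_) r⊤+y ⟨
      x + (r ⊤ + y)                ≡⟨ cong (x +_) (+-comm (r ⊤) y) ⟩
      x + (y + r ⊤)                ≡⟨ +-assoc x y (r ⊤) ⟨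
      x + y + r ⊤                  ∎

-- Partitions into unions of arms

module Coarsening (arm : Fin n → Fin m) (P : Fin n → Fin k) (I : Fin k → Subset m)
                  (block-P≡ : ∀ i → block P i ≡ blockUnion arm (I i))
                  (arm-nonempty : ∀ a → Nonempty (block arm a)) where

  -- Every arm lies inside a single block of P; label names that block.
  label : Fin m → Fin k
  label a = P (proj₁ (arm-nonempty a))

  label-∈ : ∀ {a i} → a ∈ I i → label a ≡ i
  label-∈ {a} {i} a∈I = ∈-block⁻ P (subst (_ ∈_) (sym (block-P≡ i)) (∈-blockUnion⁺ arm armE∈I))
    where
    armE∈I : arm (proj₁ (arm-nonempty a)) ∈ I i
    armE∈I = subst (_∈ I i) (sym (∈-block⁻ arm (proj₂ (arm-nonempty a)))) a∈I

  P≗label∘arm : ∀ e → P e ≡ label (arm e)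
  P≗label∘arm e = sym (label-∈ (∈-blockUnion⁻ arm (subst (e ∈_) (block-P≡ (P e)) (∈-block⁺ P refl))))

  blockUnion-P : ∀ S → blockUnion P S ≡ blockUnion arm (blockUnion label S)
  blockUnion-P S = tabulate-cong λ e →
    trans (cong (lookup S) (P≗label∘arm e)) (sym (lookup∘tabulate (lookup S ∘ label) (arm e)))

  I⊆blockUnion-label : ∀ {i S} → i ∈ S → I i ⊆ blockUnion label S
  I⊆blockUnion-label i∈S a∈I = ∈-blockUnion⁺ label (subst (_∈ _) (sym (label-∈ a∈I)) i∈S)

  I⊆∁blockUnion-label : ∀ {i S} → i ∈ ∁ S → I i ⊆ ∁ (blockUnion label S)
  I⊆∁blockUnion-label {S = S} i∈∁S =
    ⊆-trans (I⊆blockUnion-label i∈∁S) (⊆-reflexive (sym (∁-blockUnion label S)))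

  I-nonempty : IsPartition P → ∀ i → Nonempty (I i)
  I-nonempty partition i with partition i
  ... | e , e∈Pᵢ = arm e , ∈-blockUnion⁻ arm (subst (e ∈_) (block-P≡ i) e∈Pᵢ)

proposition5p6 : ∀ {n m k : ℕ} (s t : ℕ) → NonZero s → NonZero t →
    (M : Matroid n) (arm : Fin n → Fin m) → IsSpike M s t m arm →
    (P : Fin n → Fin k) → IsPartition P →
    (∀ i → Σ (Subset m) (λ I → (block P i ≡ blockUnion arm I) × ((s ∸ 1) ⊔ (t ∸ 1) ≤ ∣ I ∣))) →
    IsAnemone M (s + t ∸ 1) P
proposition5p6 (suc x) (suc y) _ _ M arm spike P partition blocks = partition , large , connected
  where
  open Spike x y M arm spike
  I = λ i → proj₁ (blocks i)

  block-P≡ : ∀ i → block P i ≡ Arms (I i)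
  block-P≡ i = proj₁ (proj₂ (blocks i))

  open Coarsening arm P I block-P≡ Arm-nonempty

  x⊔y≤∣I∣ : ∀ i → x ⊔ y ≤ ∣ I i ∣
  x⊔y≤∣I∣ i = proj₂ (proj₂ (blocks i))

  order : x + suc y ∸ 1 ≡ x + y
  order = cong (_∸ 1) (+-suc x y)

  large : ∀ i → x + suc y ∸ 1 ≤ ∣ block P i ∣
  large i = subst₂ _≤_ (sym order) (sym (trans (cong ∣_∣ (block-P≡ i)) (∣Arms∣ (I i))))
                   (+-mono-≤ (≤-trans (m≤m⊔n x y) (x⊔y≤∣I∣ i)) (≤-trans (m≤n⊔m x y) (x⊔y≤∣I∣ i)))

  connected : ∀ S → Nonempty S → Nonempty (∁ S) → conn M (blockUnion P S) ≡ x + suc y ∸ 1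
  connected S (i₀ , i₀∈S) (i₁ , i₁∈∁S) = begin
    conn M (blockUnion P S)            ≡⟨ cong (conn M) (blockUnion-P S) ⟩
    conn M (Arms (blockUnion label S)) ≡⟨ conn-Arms (large-∪ (I⊆blockUnion-label i₀∈S))
                                                    (large-∪ (I⊆∁blockUnion-label i₁∈∁S))
                                                    (map₂ (I⊆∁blockUnion-label i₁∈∁S) (I-nonempty partition i₁)) ⟩
    x + y                              ≡⟨ order ⟨
    x + suc y ∸ 1                      ∎
    where
    open ≡-Reasoning
    large-∪ : ∀ {i J} → I i ⊆ J → x ⊔ y ≤ ∣ J ∣
    large-∪ {i} I⊆J = ≤-trans (x⊔y≤∣I∣ i) (p⊆q⇒∣p∣≤∣q∣ I⊆J)
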